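{- Fix an integer $n\geq 2$. For any positive integer $k$ satisfying $k+2^k-1\leq n$ and any positive integer $c$ satisfying $n-2^k+1\leq c\leq (n-k-2^k+2)2^k-1$, there is an arithmetical structure on $K_n$ with $r_1=c$.
   Context: An arithmetical structure on the complete graph $K_n$ (with $n$ vertices) is a collection of positive integers $r_1,r_2,\dotsc,r_n$ with $\gcd(r_1,\dotsc,r_n)=1$ such that $r_j$ divides $\sum_{i=1}^n r_i$ for every $j$. The values are ordered so that $r_1\geq r_2\geq\dotsb\geq r_n$; thus $r_1$ is the largest value of the structure. -}

module Defs where

open import Data.Nat using (ℕ; _+_; _≤_; _<_)
open import Data.Nat.Divisibility using (_∣_)
open import Data.Nat.GCD using (gcd)
open import Data.Fin using (Fin) renaming (_≤_ to _≤ᶠ_)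
open import Data.Vec.Functional using (Vector; foldr)
open import Relation.Binary.PropositionalEquality using (_≡_)

sumV : ∀ {n} → Vector ℕ n → ℕ
sumV = foldr _+_ 0

gcdV : ∀ {n} → Vector ℕ n → ℕ
gcdV = foldr gcd 0

-- entries ordered r₁ ≥ r₂ ≥ ... ≥ rₙ (index 0 holds r₁, the largest value)
NonIncreasing : ∀ {n} → Vector ℕ n → Set
NonIncreasing {n} r = (i j : Fin n) → i ≤ᶠ j → r j ≤ r i

-- An arithmetical structure on the complete graph K_n:
-- positive integers r₁ ≥ ... ≥ rₙ with gcd 1 such that every r j divides the sum.
record ArithStructure (n : ℕ) (r : Vector ℕ n) : Set where
  field
    positive : (i : Fin n) → 0 < r i
    gcd≡1    : gcdV r ≡ 1
    divides  : (j : Fin n) → r j ∣ sumV r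
    ordered  : NonIncreasing r

{-# OPTIONS --safe #-}
-- Write N = 2^k and n = m + 1. Take r = (c, ..., c, p₁, ..., p_L): N - 1 copies of c followed by
-- L = n - N + 1 non-increasing divisors of N with sum c, one of them equal to 1. The total is N c,
-- which every entry divides, and the entry 1 makes the gcd 1. Such parts exist whenever
-- L ≤ c < (L - k + 1) N, by induction on k: while c is too large for parts dividing 2^(k-1),
-- greedily take a part 2^k.
module Submission where

open import Defs
open import Data.Nat using (ℕ; suc; _+_; _*_; _∸_; _^_; _≤_; _<_)
open import Data.Fin using (zero)
open import Data.Vec.Functional using (Vector)
open import Data.Product using (Σ; _×_)
open import Relation.Binary.PropositionalEquality using (_≡_)

open import Data.Nat using (zero; z≤n; s≤s; _≥_; _<?_; NonZero)
open import Data.Nat.Properties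
open import Data.Nat.Divisibility using (_∣_; ∣-refl; ∣-trans; ∣⇒≤; 0∣⇒≡0; 1∣_; m∣m*n; n∣m*n)
open import Data.Nat.GCD using (gcd; gcd-zeroˡ; gcd-zeroʳ)
open import Data.Nat.ListAction using (sum)
open import Data.Nat.ListAction.Properties using (sum-++)
open import Data.Nat.Tactic.RingSolver using (solve-∀)
import Data.Vec.Functional as Vector
open import Data.List using (List; []; _∷_; _++_; replicate; length; lookup)
import Data.List as List
open import Data.List.Properties using (length-++; length-replicate)
open import Data.List.Membership.Propositional using (_∈_)
open import Data.List.Membership.Propositional.Properties using (∈-lookup; ∈-++⁺ʳ)
open import Data.List.Relation.Unary.All as All using (All; []; _∷_)
open import Data.List.Relation.Unary.All.Properties using (replicate⁺; ++⁺)
open import Data.List.Relation.Unary.Any using (here; there)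
open import Data.List.Relation.Unary.AllPairs using (AllPairs; []; _∷_)
import Data.List.Relation.Unary.AllPairs.Properties as AllPairs
open import Data.List.Relation.Unary.Sorted.TotalOrder.Properties using (AllPairs⇒Sorted; lookup-mono-≤)
open import Relation.Binary.Properties.TotalOrder ≤-totalOrder using (≥-totalOrder)
open import Data.Product using (_,_)
open import Relation.Nullary using (yes; no; contradiction)
open import Relation.Binary.PropositionalEquality
  using (refl; sym; trans; cong; cong₂; subst; subst₂; module ≡-Reasoning)

-- Indexed by m for the graph K_{m+1}, so that the index zero of r₁ exists.
HasStructureWithLargest : ℕ → ℕ → Set
HasStructureWithLargest m c = Σ (Vector ℕ (suc m)) (λ r → ArithStructure (suc m) r × r zero ≡ c)

foldr-fromList : (f : ℕ → ℕ → ℕ) (e : ℕ) (xs : List ℕ) →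
                 Vector.foldr f e (Vector.fromList xs) ≡ List.foldr f e xs
foldr-fromList f e []       = refl
foldr-fromList f e (x ∷ xs) = cong (f x) (foldr-fromList f e xs)

foldr-gcd-∈1 : ∀ {xs} → 1 ∈ xs → List.foldr gcd 0 xs ≡ 1
foldr-gcd-∈1 {_ ∷ xs} (here refl) = gcd-zeroˡ (List.foldr gcd 0 xs)
foldr-gcd-∈1 {x ∷ _}  (there 1∈xs) rewrite foldr-gcd-∈1 1∈xs = gcd-zeroʳ x

∈⇒≤sum : ∀ {n ns} → n ∈ ns → n ≤ sum ns
∈⇒≤sum {ns = n ∷ ns} (here refl) = m≤m+n n (sum ns)
∈⇒≤sum {ns = m ∷ ns} (there n∈ns) = ≤-trans (∈⇒≤sum n∈ns) (m≤n+m (sum ns) m)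

∣⇒positive : ∀ {m n} → 0 < n → m ∣ n → 0 < m
∣⇒positive {zero}  0<n 0∣n = contradiction (0∣⇒≡0 0∣n) (>⇒≢ 0<n)
∣⇒positive {suc _} _   _   = s≤s z≤n

arithStructure-fromList : ∀ {xs} → AllPairs _≥_ xs → 1 ∈ xs → All (_∣ sum xs) xs →
                          ArithStructure (length xs) (Vector.fromList xs)
arithStructure-fromList {xs} descending 1∈xs divides = record
  { positive = λ i → ∣⇒positive (∈⇒≤sum 1∈xs) (entry divides i)
  ; gcd≡1    = trans (foldr-fromList gcd 0 xs) (foldr-gcd-∈1 1∈xs)
  ; divides  = λ j → subst (lookup xs j ∣_) (sym (foldr-fromList _+_ 0 xs)) (entry divides j)
  ; ordered  = λ i j → lookup-mono-≤ ≥-totalOrder (AllPairs⇒Sorted ≥-totalOrder descending)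
  }
  where
  entry : ∀ {P : ℕ → Set} → All P xs → ∀ i → P (lookup xs i)
  entry ps i = All.lookup ps (∈-lookup i)

n<2^n : ∀ n → n < 2 ^ n
n<2^n zero    = s≤s z≤n
n<2^n (suc n) = +-mono-≤ (m^n>0 2 n) (≤-trans (n<2^n n) (m≤m+n (2 ^ n) 0))

record DyadicPartition (k L c : ℕ) : Set where
  field
    parts      : List ℕ
    length≡    : length parts ≡ L
    sum≡       : sum parts ≡ c
    descending : AllPairs _≥_ parts
    ∣2^k       : All (_∣ 2 ^ k) parts
    1∈parts    : 1 ∈ parts

open DyadicPartition

singleton : ∀ k → DyadicPartition k 1 1
singleton k = record
  { parts = 1 ∷ [] ; length≡ = refl ; sum≡ = refl ; descending = [] ∷ []
  ; ∣2^k = 1∣ (2 ^ k) ∷ [] ; 1∈parts = here refl }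

cons : ∀ {k L c} → DyadicPartition k L c → DyadicPartition k (suc L) (2 ^ k + c)
cons {k} P = record
  { parts      = 2 ^ k ∷ parts P
  ; length≡    = cong suc (length≡ P)
  ; sum≡       = cong (2 ^ k +_) (sum≡ P)
  ; descending = All.map (∣⇒≤ {{m^n≢0 2 k}}) (∣2^k P) ∷ descending P
  ; ∣2^k       = ∣-refl ∷ ∣2^k P
  ; 1∈parts    = there (1∈parts P)
  }

widen : ∀ {k L c} → DyadicPartition k L c → DyadicPartition (suc k) L c
widen P = record
  { parts = parts P ; length≡ = length≡ P ; sum≡ = sum≡ P ; descending = descending P
  ; ∣2^k = All.map (λ d∣2^k → ∣-trans d∣2^k (n∣m*n 2)) (∣2^k P) ; 1∈parts = 1∈parts P }

ones : ∀ L → DyadicPartition 0 (suc L) (suc L)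
ones zero    = singleton 0
ones (suc L) = cons (ones L)

[3+f]*2^k≤c⇒1+k+f+2^[1+k]≤c : ∀ k f c → suc (suc (suc f)) * 2 ^ k ≤ c → suc k + f + 2 ^ suc k ≤ c
[3+f]*2^k≤c⇒1+k+f+2^[1+k]≤c k f c big = begin
  suc k + f + 2 ^ suc k          ≤⟨ +-monoˡ-≤ (2 ^ suc k) (+-mono-≤ (n<2^n k) f≤f*2^k) ⟩
  suc f * 2 ^ k + 2 * 2 ^ k      ≡⟨ *-distribʳ-+ (2 ^ k) (suc f) 2 ⟨
  (suc f + 2) * 2 ^ k            ≡⟨ cong (_* 2 ^ k) (+-comm (suc f) 2) ⟩
  suc (suc (suc f)) * 2 ^ k      ≤⟨ big ⟩
  c                              ∎
  where
  open ≤-Reasoning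
  f≤f*2^k : f ≤ f * 2 ^ k
  f≤f*2^k = m≤m*n f (2 ^ k) {{m^n≢0 2 k}}

m<[2+f]*n⇒m∸n<[1+f]*n : ∀ {m} f n .{{_ : NonZero n}} → m < suc (suc f) * n → m ∸ n < suc f * n
m<[2+f]*n⇒m∸n<[1+f]*n {m} f n = m<n+o⇒m∸n<o m n {{m*n≢0 (suc f) n}}

DyadicPartitionsExist : ℕ → Set
DyadicPartitionsExist k =
  ∀ d c → 1 ≤ k + d → k + d ≤ c → c < suc d * 2 ^ k → DyadicPartition k (k + d) c

dyadicPartitionsExist-zero : DyadicPartitionsExist 0
dyadicPartitionsExist-zero (suc d) c _ L≤c c<bound =
  subst (DyadicPartition 0 (suc d))
    (≤-antisym L≤c (≤-pred (subst (c <_) (*-identityʳ (suc (suc d))) c<bound)))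
    (ones d)

dyadicPartitionsExist-suc : ∀ {k} → DyadicPartitionsExist k → DyadicPartitionsExist (suc k)
dyadicPartitionsExist-suc {k} exist d c 1≤L L≤c c<bound with c <? suc (suc d) * 2 ^ k
... | yes c<half = subst (λ L → DyadicPartition (suc k) L c) (+-suc k d)
  (widen (exist (suc d) c (subst (1 ≤_) (sym (+-suc k d)) 1≤L)
                          (subst (_≤ c) (sym (+-suc k d)) L≤c) c<half))
dyadicPartitionsExist-suc {k} exist zero    c _ _ c<bound | no c≮half =
  contradiction (subst (c <_) (*-identityˡ (2 ^ suc k)) c<bound) c≮half
dyadicPartitionsExist-suc {k} exist (suc f) c _ _ c<bound | no c≮half =
  subst₂ (DyadicPartition (suc k)) (sym (+-suc (suc k) f)) (m+[n∸m]≡n (m+n≤o⇒n≤o (suc k + f) room))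
    (cons (dyadicPartitionsExist-suc exist f (c ∸ 2 ^ suc k) (s≤s z≤n)
            (m+n≤o⇒m≤o∸n (suc k + f) room) remainder<bound))
  where
  remainder<bound : c ∸ 2 ^ suc k < suc f * 2 ^ suc k
  remainder<bound = m<[2+f]*n⇒m∸n<[1+f]*n f (2 ^ suc k) {{m^n≢0 2 (suc k)}} c<bound

  room : suc k + f + 2 ^ suc k ≤ c
  room = [3+f]*2^k≤c⇒1+k+f+2^[1+k]≤c k f c (≮⇒≥ c≮half)

dyadicPartitionsExist : ∀ k → DyadicPartitionsExist k
dyadicPartitionsExist zero    = dyadicPartitionsExist-zero
dyadicPartitionsExist (suc k) = dyadicPartitionsExist-suc (dyadicPartitionsExist k)

allPairs-replicate : ∀ {R : ℕ → ℕ → Set} {x} → R x x → ∀ n → AllPairs R (replicate n x)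
allPairs-replicate Rxx zero    = []
allPairs-replicate Rxx (suc n) = replicate⁺ n Rxx ∷ allPairs-replicate Rxx n

sum-replicate : ∀ n x → sum (replicate n x) ≡ n * x
sum-replicate zero    x = refl
sum-replicate (suc n) x = cong (x +_) (sum-replicate n x)

partition⇒structure : ∀ {k K L c} → 2 ^ k ≡ 2 + K → DyadicPartition k L c →
                      HasStructureWithLargest (K + L) c
partition⇒structure {k} {K} {L} {c} 2^k≡2+K P =
  subst (λ n → HasStructureWithLargest n c) length≡K+L
    (Vector.fromList xs , arithStructure-fromList descending-xs 1∈xs divides-sum , refl)
  where
  xs : List ℕ
  xs = replicate (suc K) c ++ parts P

  length≡K+L : length (replicate K c ++ parts P) ≡ K + L
  length≡K+L = trans (length-++ (replicate K c)) (cong₂ _+_ (length-replicate K) (length≡ P))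

  parts≤c : All (_≤ c) (parts P)
  parts≤c = All.tabulate (λ {x} x∈parts → subst (x ≤_) (sum≡ P) (∈⇒≤sum x∈parts))

  descending-xs : AllPairs _≥_ xs
  descending-xs = AllPairs.++⁺ (allPairs-replicate ≤-refl (suc K)) (descending P)
                    (replicate⁺ (suc K) parts≤c)

  1∈xs : 1 ∈ xs
  1∈xs = ∈-++⁺ʳ (replicate (suc K) c) (1∈parts P)

  sum≡2^k*c : sum xs ≡ 2 ^ k * c
  sum≡2^k*c = begin
    sum xs                                    ≡⟨ sum-++ (replicate (suc K) c) (parts P) ⟩
    sum (replicate (suc K) c) + sum (parts P) ≡⟨ cong₂ _+_ (sum-replicate (suc K) c) (sum≡ P) ⟩
    suc K * c + c                             ≡⟨ +-comm (suc K * c) c ⟩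
    (2 + K) * c                               ≡⟨ cong (_* c) 2^k≡2+K ⟨
    2 ^ k * c                                 ∎
    where open ≡-Reasoning

  divides-2^k*c : All (_∣ 2 ^ k * c) xs
  divides-2^k*c = ++⁺ (replicate⁺ (suc K) (n∣m*n (2 ^ k)))
                      (All.map (λ x∣2^k → ∣-trans x∣2^k (m∣m*n c)) (∣2^k P))

  divides-sum : All (_∣ sum xs) xs
  divides-sum = subst (λ s → All (_∣ s) xs) (sym sum≡2^k*c) divides-2^k*c

[1+K+L]∸[2+K]+1≡L : ∀ K k d → suc (K + (suc k + d)) ∸ (2 + K) + 1 ≡ suc k + d
[1+K+L]∸[2+K]+1≡L K k d = begin
  K + suc (k + d) ∸ suc K + 1   ≡⟨ cong (λ x → x ∸ suc K + 1) (+-suc K (k + d)) ⟩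
  suc K + (k + d) ∸ suc K + 1   ≡⟨ cong (_+ 1) (m+n∸m≡n (suc K) (k + d)) ⟩
  k + d + 1                     ≡⟨ +-comm (k + d) 1 ⟩
  suc k + d                     ∎
  where open ≡-Reasoning

[1+K+L]+2∸k∸[2+K]≡1+d : ∀ K k d → suc (K + (k + d)) + 2 ∸ k ∸ (2 + K) ≡ suc d
[1+K+L]+2∸k∸[2+K]≡1+d K k d = begin
  suc (K + (k + d)) + 2 ∸ k ∸ (2 + K)   ≡⟨ cong (λ x → x ∸ k ∸ (2 + K)) (regroup K k d) ⟩
  k + (suc d + (2 + K)) ∸ k ∸ (2 + K)   ≡⟨ cong (_∸ (2 + K)) (m+n∸m≡n k (suc d + (2 + K))) ⟩
  suc d + (2 + K) ∸ (2 + K)             ≡⟨ m+n∸n≡m (suc d) (2 + K) ⟩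
  suc d                                 ∎
  where
  open ≡-Reasoning
  regroup : ∀ K k d → suc (K + (k + d)) + 2 ≡ k + (suc d + (2 + K))
  regroup = solve-∀

m≡K+[k+[1+m∸[1+K+k]]] : ∀ {m} K k → k + (2 + K) ∸ 1 ≤ suc m →
                         m ≡ K + (k + (suc m ∸ (suc K + k)))
m≡K+[k+[1+m∸[1+K+k]]] {m} K k fits = suc-injective (begin
  suc m                            ≡⟨ m+[n∸m]≡n 1+K+k≤1+m ⟨
  suc K + k + (suc m ∸ (suc K + k)) ≡⟨ cong suc (+-assoc K k _) ⟩
  suc (K + (k + (suc m ∸ (suc K + k)))) ∎)
  where
  open ≡-Reasoning
  1+K+k≤1+m : suc K + k ≤ suc m
  1+K+k≤1+m = subst (_≤ suc m) (trans (cong (_∸ 1) (+-suc k (suc K))) (+-comm k (suc K))) fits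

-- K = 2^k - 2 copies of c follow r₁ = c, then L = k + d parts.
bounds⇒structure : ∀ {m} K k d c → m ≡ K + (k + d) → 2 ^ k ≡ 2 + K → 1 ≤ k →
                   suc m ∸ 2 ^ k + 1 ≤ c → c ≤ (suc m + 2 ∸ k ∸ 2 ^ k) * 2 ^ k ∸ 1 →
                   HasStructureWithLargest m c
bounds⇒structure K k@(suc _) d c refl 2^k≡2+K _ lower upper =
  partition⇒structure 2^k≡2+K (dyadicPartitionsExist k d c (s≤s z≤n) L≤c c<bound)
  where
  L≤c : k + d ≤ c
  L≤c = subst (_≤ c) ([1+K+L]∸[2+K]+1≡L K _ d)
          (subst (λ N → suc (K + (k + d)) ∸ N + 1 ≤ c) 2^k≡2+K lower)

  c<bound : c < suc d * 2 ^ k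
  c<bound = subst (λ N → c < suc d * N) (sym 2^k≡2+K)
    (s≤s (subst (λ x → c ≤ x * (2 + K) ∸ 1) ([1+K+L]+2∸k∸[2+K]≡1+d K k d)
           (subst (λ N → c ≤ (suc (K + (k + d)) + 2 ∸ k ∸ N) * N ∸ 1) 2^k≡2+K upper)))

proposition2p4 : (m : ℕ) → 2 ≤ suc m → (k c : ℕ) → 1 ≤ k → 1 ≤ c →
    k + 2 ^ k ∸ 1 ≤ suc m →
    suc m ∸ 2 ^ k + 1 ≤ c →
    c ≤ (suc m + 2 ∸ k ∸ 2 ^ k) * 2 ^ k ∸ 1 →
    Σ (Vector ℕ (suc m)) (λ r → ArithStructure (suc m) r × r zero ≡ c)
-- The hypotheses 2 ≤ n and 1 ≤ c follow from the others.
proposition2p4 m _ k c 1≤k _ fits lower upper =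
  bounds⇒structure K k (suc m ∸ (suc K + k)) c
    (m≡K+[k+[1+m∸[1+K+k]]] K k (subst (λ N → k + N ∸ 1 ≤ suc m) 2^k≡2+K fits))
    2^k≡2+K 1≤k lower upper
  where
  K : ℕ
  K = 2 ^ k ∸ 2
  2^k≡2+K : 2 ^ k ≡ 2 + K
  2^k≡2+K = sym (m+[n∸m]≡n (^-monoʳ-≤ 2 1≤k))
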